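{- Let $\mathbf{A}$ be a relational structure with $ghw(\mathbf{A})\le k$. Then there exists a structure $\mathbf{A}'$ that is homomorphically equivalent to $\mathbf{A}$ and satisfies $hw(\mathbf{A}')\le k$.
   Context: Two structures are homomorphically equivalent if there are homomorphisms in both directions. The hypergraph of a structure has its domain as vertices and a hyperedge $\{a_1,\dots,a_k\}$ per tuple $(a_1,\dots,a_k)$ of any relation; widths of structures are those of their hypergraphs. A generalized hypertree decomposition (GHD) of a hypergraph $H$ is a rooted tree $T$ with bags $B_u\subseteq V(H)$ and covers $\lambda_u\subseteq E(H)$ such that each vertex's bags form a connected subtree, each hyperedge lies in some bag, and $B_u\subseteq\bigcup\lambda_u$. A hypertree decomposition is a GHD additionally satisfying $(\bigcup\lambda_u)\cap B(T_u)\subseteq B_u$ for all $u$, where $B(T_u)$ is the union of the bags in the subtree rooted at $u$. Width is $\max_u|\lambda_u|$; $ghw$ and $hw$ are the minimum widths of GHDs and hypertree decompositions respectively. -}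

module Defs where

open import Data.Nat using (ℕ; suc; _≤_)
open import Data.Fin using (Fin; zero; suc; toℕ)
open import Data.Fin.Subset as FS using (Subset; ⋃; ⁅_⁆; _∪_)
open import Data.Vec using (Vec)
import Data.Vec as Vec
open import Data.List using (List; length; concatMap; allFin)
open import Data.List.Membership.Propositional as LM using ()
open import Data.Product using (Σ; ∃; _×_; _,_)
open import Data.Sum using (_⊎_)
open import Relation.Binary.PropositionalEquality using (_≡_)

record Signature : Set where
  field
    nsym  : ℕ
    arity : Fin nsym → ℕ
open Signature public

record Structure (σ : Signature) : Set where
  field
    size : ℕ
    rel  : (R : Fin (nsym σ)) → List (Vec (Fin size) (arity σ R))
open Structure public

Hom : {σ : Signature} → Structure σ → Structure σ → Set
Hom {σ} A B =
  Σ (Fin (size A) → Fin (size B)) λ f →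
    (R : Fin (nsym σ)) (t : Vec (Fin (size A)) (arity σ R)) →
    t LM.∈ rel A R → Vec.map f t LM.∈ rel B R

HomEquiv : {σ : Signature} → Structure σ → Structure σ → Set
HomEquiv A B = Hom A B × Hom B A

record Hypergraph : Set where
  field
    nv    : ℕ
    edges : List (Subset nv)
open Hypergraph public

elems : ∀ {n k} → Vec (Fin n) k → Subset n
elems t = Vec.foldr _ (λ a s → ⁅ a ⁆ ∪ s) FS.⊥ t

hypergraph : {σ : Signature} → Structure σ → Hypergraph
hypergraph {σ} A = record
  { nv    = size A
  ; edges = concatMap (λ R → Data.List.map elems (rel A R)) (allFin (nsym σ)) }

-- Rooted trees: nodes Fin (suc m), root = zero, node (suc i) has parent
-- (parent i), with the parent having smaller index (this encodes
-- exactly the finite rooted trees, up to relabelling).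

record RootedTree : Set where
  field
    m       : ℕ
    parent  : Fin m → Fin (suc m)
    parent≤ : (i : Fin m) → toℕ (parent i) ≤ toℕ i
open RootedTree public

Node : RootedTree → Set
Node T = Fin (suc (m T))

Adj : (T : RootedTree) → Node T → Node T → Set
Adj T u v = (∃ λ i → u ≡ suc i × v ≡ parent T i)
          ⊎ (∃ λ i → v ≡ suc i × u ≡ parent T i)

data WalkIn (T : RootedTree) (S : Node T → Set) : Node T → Node T → Set where
  stop : ∀ {u} → S u → WalkIn T S u u
  step : ∀ {u v w} → S u → Adj T u v → WalkIn T S v w → WalkIn T S u w

Connected : (T : RootedTree) → (Node T → Set) → Set
Connected T S = ∀ u w → S u → S w → WalkIn T S u w

data Desc (T : RootedTree) (u : Node T) : Node T → Set where
  self  : Desc T u u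
  child : ∀ i → Desc T u (parent T i) → Desc T u (suc i)

record GHD (H : Hypergraph) : Set where
  field
    tree  : RootedTree
    bag   : Node tree → Subset (nv H)
    cover : Node tree → List (Subset (nv H))
    cover⊆E   : ∀ u e → e LM.∈ cover u → e LM.∈ edges H
    connected : ∀ (v : Fin (nv H)) → Connected tree (λ u → v FS.∈ bag u)
    edgeInBag : ∀ e → e LM.∈ edges H → ∃ λ u → e FS.⊆ bag u
    bag⊆cover : ∀ u → bag u FS.⊆ ⋃ (cover u)
open GHD public

SpecialCondition : {H : Hypergraph} → GHD H → Set
SpecialCondition {H} D =
  ∀ (u : Node (tree D)) (v : Fin (nv H)) →
    v FS.∈ ⋃ (cover D u) →
    (∃ λ w → Desc (tree D) u w × v FS.∈ bag D w) →
    v FS.∈ bag D u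

WidthAtMost : {H : Hypergraph} → GHD H → ℕ → Set
WidthAtMost D k = ∀ u → length (cover D u) ≤ k

ghw≤ : Hypergraph → ℕ → Set
ghw≤ H k = Σ (GHD H) λ D → WidthAtMost D k

hw≤ : Hypergraph → ℕ → Set
hw≤ H k = Σ (GHD H) λ D → SpecialCondition D × WidthAtMost D k

-- Keep the tree of the generalized hypertree decomposition. For every node u and every edge
-- of λ_u pick a tuple of A spanning it, and add to A a copy of that tuple in which each
-- element outside B_u is replaced by a fresh element private to u. A embeds into the
-- resulting A′, and collapsing every fresh element onto its original is a homomorphism back.
-- In the new decomposition λ′_u consists of the copied edges and B′_u is their union, so
-- the special condition is trivial and the width is unchanged; an old element lies in B′_u
-- exactly when it lies in B_u, and a fresh element of u only in B′_u, so connectedness of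
-- the bags is inherited from the original decomposition.
module Submission where

open import Defs
open import Data.Nat using (ℕ; suc; _+_; _*_)
open import Data.Nat.Properties using (≤-reflexive; ≤-trans)
open import Data.Product using (Σ; ∃; _×_; _,_; proj₁; proj₂)
open import Data.Sum using (_⊎_; inj₁; inj₂; [_,_])
open import Data.Sum.Properties using (inj₁-injective; inj₂-injective)
open import Data.Empty using (⊥-elim)
open import Data.Fin using (Fin)
open import Data.Fin.Properties using (+↔⊎; *↔×; _≟_)
open import Data.Fin.Subset as FS using (Subset; ⋃; ⁅_⁆)
open import Data.Fin.Subset.Properties using (_∈?_; ∉⊥; x∈⁅x⁆; x∈⁅y⁆⇒x≡y; x∈p∪q⁻; x∈p∪q⁺)
open import Data.Vec as Vec using (Vec; []; _∷_)
open import Data.Vec.Properties using (map-∘; map-cong; map-id)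
open import Data.List as List using (List; []; _∷_; _++_; concatMap; allFin; length)
open import Data.List.Properties using (length-map)
open import Data.List.Membership.Propositional as LM using (find; lose; mapWith∈)
open import Data.List.Membership.Propositional.Properties
  using (∈-map⁺; ∈-map⁻; ∈-++⁺ˡ; ∈-++⁺ʳ; ∈-++⁻; ∈-concatMap⁺; ∈-concatMap⁻; ∈-allFin)
import Data.List.Membership.Setoid.Properties as SetoidMembership
open import Data.List.Relation.Unary.Any using (here; there)
open import Data.List.Relation.Unary.Any.Properties using (mapWith∈⁺)
open import Data.Sum.Function.Propositional using (_⊎-↔_)
open import Function using (id; _∘_; case_of_; _↔_; Inverse)
open import Function.Properties.Inverse using (↔-refl; ↔-sym; ↔-trans)
open import Relation.Binary.PropositionalEquality using (_≡_; refl; sym; trans; cong; subst; setoid; module ≡-Reasoning)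
open import Relation.Nullary using (yes; no)

x∈⋃⁺ : ∀ {n} {x : Fin n} {e es} → e LM.∈ es → x FS.∈ e → x FS.∈ ⋃ es
x∈⋃⁺ (here refl) x∈e = x∈p∪q⁺ (inj₁ x∈e)
x∈⋃⁺ (there e∈es) x∈e = x∈p∪q⁺ (inj₂ (x∈⋃⁺ e∈es x∈e))

x∈⋃⁻ : ∀ {n} {x : Fin n} (es : List (Subset n)) → x FS.∈ ⋃ es → ∃ λ e → e LM.∈ es × x FS.∈ e
x∈⋃⁻ [] x∈⊥ = ⊥-elim (∉⊥ x∈⊥)
x∈⋃⁻ (e ∷ es) x∈ with x∈p∪q⁻ e (⋃ es) x∈
... | inj₁ x∈e = e , here refl , x∈e
... | inj₂ x∈⋃es with x∈⋃⁻ es x∈⋃es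
...   | e′ , e′∈es , x∈e′ = e′ , there e′∈es , x∈e′

x∈elems-map⁺ : ∀ {n n′ k} (f : Fin n → Fin n′) (t : Vec (Fin n) k) {x} →
  x FS.∈ elems t → f x FS.∈ elems (Vec.map f t)
x∈elems-map⁺ f [] x∈⊥ = ⊥-elim (∉⊥ x∈⊥)
x∈elems-map⁺ f (a ∷ t) x∈ with x∈p∪q⁻ ⁅ a ⁆ (elems t) x∈
... | inj₁ x∈⁅a⁆ rewrite x∈⁅y⁆⇒x≡y a x∈⁅a⁆ = x∈p∪q⁺ (inj₁ (x∈⁅x⁆ (f a)))
... | inj₂ x∈t = x∈p∪q⁺ (inj₂ (x∈elems-map⁺ f t x∈t))

x∈elems-map⁻ : ∀ {n n′ k} (f : Fin n → Fin n′) (t : Vec (Fin n) k) {y} →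
  y FS.∈ elems (Vec.map f t) → ∃ λ x → x FS.∈ elems t × y ≡ f x
x∈elems-map⁻ f [] y∈⊥ = ⊥-elim (∉⊥ y∈⊥)
x∈elems-map⁻ f (a ∷ t) y∈ with x∈p∪q⁻ ⁅ f a ⁆ (elems (Vec.map f t)) y∈
... | inj₁ y∈⁅fa⁆ = a , x∈p∪q⁺ (inj₁ (x∈⁅x⁆ a)) , x∈⁅y⁆⇒x≡y (f a) y∈⁅fa⁆
... | inj₂ y∈ft with x∈elems-map⁻ f t y∈ft
...   | x , x∈t , y≡fx = x , x∈p∪q⁺ (inj₂ x∈t) , y≡fx

map-inverseˡ : ∀ {A B : Set} {k} {f : A → B} {g : B → A} →
  (∀ x → g (f x) ≡ x) → (t : Vec A k) → Vec.map g (Vec.map f t) ≡ t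
map-inverseˡ {f = f} {g} g∘f≗id t = begin
  Vec.map g (Vec.map f t) ≡⟨ map-∘ g f t ⟨
  Vec.map (g ∘ f) t       ≡⟨ map-cong g∘f≗id t ⟩
  Vec.map id t            ≡⟨ map-id t ⟩
  t                       ∎
  where open ≡-Reasoning

WalkIn-map : ∀ {T : RootedTree} {S S′ : Node T → Set} → (∀ u → S u → S′ u) →
  ∀ {u w} → WalkIn T S u w → WalkIn T S′ u w
WalkIn-map S⊆S′ (stop {u} u∈S) = stop (S⊆S′ u u∈S)
WalkIn-map S⊆S′ (step {u} u∈S u~v walk) = step (S⊆S′ u u∈S) u~v (WalkIn-map S⊆S′ walk)

module _ {σ : Signature} (A : Structure σ) where

  record Fact : Set where
    constructor fact
    field
      symbol : Fin (nsym σ)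
      tuple  : Vec (Fin (size A)) (arity σ symbol)
      tuple∈ : tuple LM.∈ rel A symbol

  open Fact

  ∈-edges⁺ : ∀ {R t} → t LM.∈ rel A R → elems t LM.∈ edges (hypergraph A)
  ∈-edges⁺ {R} t∈R =
    ∈-concatMap⁺ (λ R → List.map elems (rel A R)) (lose (∈-allFin R) (∈-map⁺ elems t∈R))

  ∈-edges⁻ : ∀ {e} → e LM.∈ edges (hypergraph A) → ∃ λ f → elems (tuple f) ≡ e
  ∈-edges⁻ e∈ with find (∈-concatMap⁻ (λ R → List.map elems (rel A R)) {xs = allFin (nsym σ)} e∈)
  ... | R , _ , e∈R with ∈-map⁻ elems e∈R
  ...   | t , t∈R , e≡t = fact R t t∈R , sym e≡t

module FreshCopies {σ : Signature} (A : Structure σ) (D : GHD (hypergraph A)) where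

  open Fact

  private
    n = size A
    T = tree D
    M = suc (m T)

  factOf : ∀ {u e} → e LM.∈ cover D u → Fact A
  factOf {u} {e} e∈ = proj₁ (∈-edges⁻ A (cover⊆E D u e e∈))

  facts : Node T → List (Fact A)
  facts u = mapWith∈ (cover D u) factOf

  length-facts : ∀ u → length (facts u) ≡ length (cover D u)
  length-facts u = SetoidMembership.length-mapWith∈ (setoid _) (cover D u)

  ⋃cover⇒fact : ∀ {u x} → x FS.∈ ⋃ (cover D u) → ∃ λ f → f LM.∈ facts u × x FS.∈ elems (tuple f)
  ⋃cover⇒fact {u} {x} x∈⋃ with x∈⋃⁻ (cover D u) x∈⋃
  ... | e , e∈ , x∈e =
    factOf e∈ , mapWith∈⁺ factOf (e , e∈ , refl) ,
    subst (x FS.∈_) (sym (proj₂ (∈-edges⁻ A (cover⊆E D u e e∈)))) x∈e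

  N′ : ℕ
  N′ = n + M * n

  vertex↔ : (Fin n ⊎ (Node T × Fin n)) ↔ Fin N′
  vertex↔ = ↔-trans (↔-refl ⊎-↔ ↔-sym *↔×) (↔-sym +↔⊎)

  open Inverse vertex↔ using (to; from; strictlyInverseʳ)

  to-injective : ∀ {a b} → to a ≡ to b → a ≡ b
  to-injective {a} {b} eq = begin
    a           ≡⟨ strictlyInverseʳ a ⟨
    from (to a) ≡⟨ cong from eq ⟩
    from (to b) ≡⟨ strictlyInverseʳ b ⟩
    b           ∎
    where open ≡-Reasoning

  old : Fin n → Fin N′
  old x = to (inj₁ x)

  fresh : Node T → Fin n → Fin N′
  fresh u x = to (inj₂ (u , x))

  collapse : Fin N′ → Fin n
  collapse = [ id , proj₂ ] ∘ from

  collapse-old : ∀ x → collapse (old x) ≡ x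
  collapse-old x = cong [ id , proj₂ ] (strictlyInverseʳ (inj₁ x))

  collapse-fresh : ∀ u x → collapse (fresh u x) ≡ x
  collapse-fresh u x = cong [ id , proj₂ ] (strictlyInverseʳ (inj₂ (u , x)))

  relabel : Node T → Fin n → Fin N′
  relabel u x with x ∈? bag D u
  ... | yes _ = old x
  ... | no _  = fresh u x

  collapse-relabel : ∀ u x → collapse (relabel u x) ≡ x
  collapse-relabel u x with x ∈? bag D u
  ... | yes _ = collapse-old x
  ... | no _  = collapse-fresh u x

  relabel-bag : ∀ {u x} → x FS.∈ bag D u → relabel u x ≡ old x
  relabel-bag {u} {x} x∈B with x ∈? bag D u
  ... | yes _   = refl
  ... | no x∉B = ⊥-elim (x∉B x∈B)

  relabel-coincide : ∀ u w x y → relabel u x ≡ relabel w y →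
    (x FS.∈ bag D u × x FS.∈ bag D w) ⊎ u ≡ w
  relabel-coincide u w x y eq with x ∈? bag D u | y ∈? bag D w
  ... | yes x∈B | yes y∈B =
    inj₁ (x∈B , subst (FS._∈ bag D w) (sym (inj₁-injective (to-injective {inj₁ x} {inj₁ y} eq))) y∈B)
  ... | no _    | no _    = inj₂ (cong proj₁ (inj₂-injective (to-injective {inj₂ (u , x)} {inj₂ (w , y)} eq)))
  ... | yes _   | no _    with () ← to-injective {inj₁ x} {inj₂ (w , y)} eq
  ... | no _    | yes _   with () ← to-injective {inj₂ (u , x)} {inj₁ y} eq

  copies : Node T → (R : Fin (nsym σ)) → Fact A → List (Vec (Fin N′) (arity σ R))
  copies u R (fact R′ t _) with R′ ≟ R
  ... | yes refl = Vec.map (relabel u) t ∷ []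
  ... | no _     = []

  copiesAt : (R : Fin (nsym σ)) → Node T → List (Vec (Fin N′) (arity σ R))
  copiesAt R u = concatMap (copies u R) (facts u)

  A′ : Structure σ
  A′ = record
    { size = N′
    ; rel  = λ R → List.map (Vec.map old) (rel A R) ++ concatMap (copiesAt R) (allFin M)
    }

  copy∈copies : ∀ u f → Vec.map (relabel u) (tuple f) LM.∈ copies u (symbol f) f
  copy∈copies u (fact R t _) with R ≟ R
  ... | yes refl = here refl
  ... | no R≢R   = ⊥-elim (R≢R refl)

  copy∈rel′ : ∀ {u f} → f LM.∈ facts u → Vec.map (relabel u) (tuple f) LM.∈ rel A′ (symbol f)
  copy∈rel′ {u} {f} f∈ =
    ∈-++⁺ʳ (List.map (Vec.map old) (rel A (symbol f)))
      (∈-concatMap⁺ (copiesAt (symbol f)) (lose (∈-allFin u)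
        (∈-concatMap⁺ (copies u (symbol f)) (lose f∈ (copy∈copies u f)))))

  ∈-rel′⁻ : ∀ {R y} → y LM.∈ rel A′ R →
    (∃ λ t → t LM.∈ rel A R × y ≡ Vec.map old t) ⊎ (∃ λ u → ∃ λ f → f LM.∈ facts u × y LM.∈ copies u R f)
  ∈-rel′⁻ {R} y∈ with ∈-++⁻ (List.map (Vec.map old) (rel A R)) y∈
  ... | inj₁ y∈old = inj₁ (∈-map⁻ (Vec.map old) y∈old)
  ... | inj₂ y∈new with find (∈-concatMap⁻ (copiesAt R) {xs = allFin M} y∈new)
  ...   | u , _ , y∈u with find (∈-concatMap⁻ (copies u R) {xs = facts u} y∈u)
  ...     | f , f∈ , y∈f = inj₂ (u , f , f∈ , y∈f)

  old-hom : Hom A A′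
  old-hom = old , λ R t t∈ → ∈-++⁺ˡ (∈-map⁺ (Vec.map old) t∈)

  copies-collapse : ∀ u R f {y} → y LM.∈ copies u R f → Vec.map collapse y LM.∈ rel A R
  copies-collapse u R (fact R′ t t∈) y∈ with R′ ≟ R | y∈
  ... | yes refl | here refl =
    subst (LM._∈ rel A R) (sym (map-inverseˡ (collapse-relabel u) t)) t∈

  collapse-hom : Hom A′ A
  collapse-hom = collapse , collapse-preserves
    where
    collapse-preserves : ∀ R y → y LM.∈ rel A′ R → Vec.map collapse y LM.∈ rel A R
    collapse-preserves R y y∈ with ∈-rel′⁻ y∈
    ... | inj₁ (t , t∈ , refl) = subst (LM._∈ rel A R) (sym (map-inverseˡ collapse-old t)) t∈
    ... | inj₂ (u , f , _ , y∈f) = copies-collapse u R f y∈f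

  copiedEdge : Node T → Fact A → Subset N′
  copiedEdge u f = elems (Vec.map (relabel u) (tuple f))

  cover′ : Node T → List (Subset N′)
  cover′ u = List.map (copiedEdge u) (facts u)

  bag′ : Node T → Subset N′
  bag′ u = ⋃ (cover′ u)

  cover′⊆edges : ∀ u e → e LM.∈ cover′ u → e LM.∈ edges (hypergraph A′)
  cover′⊆edges u e e∈ with ∈-map⁻ (copiedEdge u) e∈
  ... | f , f∈ , refl = ∈-edges⁺ A′ (copy∈rel′ f∈)

  ∈bag′⁻ : ∀ {u v} → v FS.∈ bag′ u → ∃ λ x → v ≡ relabel u x
  ∈bag′⁻ {u} v∈ with x∈⋃⁻ (cover′ u) v∈
  ... | e , e∈ , v∈e with ∈-map⁻ (copiedEdge u) e∈
  ...   | f , _ , refl with x∈elems-map⁻ (relabel u) (tuple f) v∈e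
  ...     | x , _ , v≡ = x , v≡

  old∈bag′ : ∀ {u x} → x FS.∈ bag D u → old x FS.∈ bag′ u
  old∈bag′ {u} {x} x∈B with ⋃cover⇒fact (bag⊆cover D u x∈B)
  ... | f , f∈ , x∈f =
    x∈⋃⁺ (∈-map⁺ (copiedEdge u) f∈)
      (subst (FS._∈ copiedEdge u f) (relabel-bag x∈B) (x∈elems-map⁺ (relabel u) (tuple f) x∈f))

  connected′ : ∀ v → Connected T (λ u → v FS.∈ bag′ u)
  connected′ v u w v∈u v∈w with ∈bag′⁻ v∈u | ∈bag′⁻ v∈w
  ... | x , v≡ | y , v≡′ with relabel-coincide u w x y (trans (sym v≡) v≡′)
  ...   | inj₂ refl = stop v∈u
  ...   | inj₁ (x∈Bu , x∈Bw) = WalkIn-map v∈bag′ (connected D x u w x∈Bu x∈Bw)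
    where
    v∈bag′ : ∀ u′ → x FS.∈ bag D u′ → v FS.∈ bag′ u′
    v∈bag′ u′ x∈Bu′ = subst (FS._∈ bag′ u′) (sym (trans v≡ (relabel-bag x∈Bu))) (old∈bag′ x∈Bu′)

  copies-edge : ∀ {u R f y} → f LM.∈ facts u → y LM.∈ copies u R f → elems y LM.∈ cover′ u
  copies-edge {u} {R} {fact R′ t t∈} f∈ y∈ with R′ ≟ R | y∈
  ... | yes refl | here refl = ∈-map⁺ (copiedEdge u) f∈

  edgeInBag′ : ∀ e → e LM.∈ edges (hypergraph A′) → ∃ λ u → e FS.⊆ bag′ u
  edgeInBag′ e e∈ with ∈-edges⁻ A′ e∈
  ... | fact R y y∈ , refl with ∈-rel′⁻ y∈
  ...   | inj₂ (u , f , f∈ , y∈f) = u , x∈⋃⁺ (copies-edge f∈ y∈f)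
  ...   | inj₁ (t , t∈ , refl) with edgeInBag D (elems t) (∈-edges⁺ A t∈)
  ...     | u , t⊆B = u , λ z∈ → case x∈elems-map⁻ old t z∈ of λ where
                (x , x∈t , refl) → old∈bag′ (t⊆B x∈t)

  D′ : GHD (hypergraph A′)
  D′ = record
    { tree      = T
    ; bag       = bag′
    ; cover     = cover′
    ; cover⊆E   = cover′⊆edges
    ; connected = connected′
    ; edgeInBag = edgeInBag′
    ; bag⊆cover = λ _ → id
    }

  D′-special : SpecialCondition D′
  D′-special u v v∈⋃ _ = v∈⋃

  D′-width : ∀ {k} → WidthAtMost D k → WidthAtMost D′ k
  D′-width width u =
    ≤-trans (≤-reflexive (trans (length-map (copiedEdge u) (facts u)) (length-facts u))) (width u)

lemma12 : (σ : Signature) (k : ℕ) (A : Structure σ) →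
    ghw≤ (hypergraph A) k →
    Σ (Structure σ) λ A' → HomEquiv A A' × hw≤ (hypergraph A') k
lemma12 σ k A (D , width) = A′ , (old-hom , collapse-hom) , (D′ , D′-special , D′-width width)
  where open FreshCopies A D
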